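{- Let $i$ be an integer and $r\ge 0$, $n$, $k\ge0$ be integers. Then $$w(i,r,n,k)=2^{n-r-2k}\prod_{m=0}^{k-1}(m+i+1)(m+i+2)\sum\prod_{m=0}^k(i+m+1)^{t_m},$$ where the sum is over all $(k+1)$-tuples $(t_0,t_1,\dots,t_k)$ of nonnegative integers with $\sum_{m=0}^k t_m=n-r-2k$.
   Context: A circular-peak path from $(r,0)$ to $(n,k)$ is a lattice path in the first quadrant starting at $(r,0)$ and ending at $(n,k)$ using only horizontal steps $H=(1,0)$ and rise steps $R=(2,1)$; it is identified with the word $e_1e_2\cdots e_{n-r-k}$ in the letters $H,R$. Let $P_{r,n,k}$ be the set of all such paths. Given an integer $i$ and $P=e_1\cdots e_{n-r-k}\in P_{r,n,k}$: if step $e_j$ goes from $(x,y)$ to $(x+1,y)$ its weight is $w_i(e_j)=2i+2(y+1)$; if $e_j$ goes from $(x,y)$ to $(x+2,y+1)$ its weight is $w_i(e_j)=(y+i+1)(y+i+2)$. The weight of $P$ is $w_i(P)=\prod_{j=1}^{n-r-k}w_i(e_j)$, and $w(i,r,n,k)=\sum_{P\in P_{r,n,k}}w_i(P)$. -}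

module Defs where

open import Data.Nat as ℕ using (ℕ; zero; suc)
open import Data.Integer as ℤ using (ℤ; +_; -[1+_]; _+_; _*_; _-_; _^_)
open import Data.List as L using (List; []; _∷_; filter; map; foldr; concatMap; upTo)
open import Data.Vec as V using (Vec; lookup; tabulate)
open import Data.Fin using (Fin; toℕ)
open import Data.Product using (_×_; _,_; proj₁; proj₂)
open import Relation.Binary.PropositionalEquality using (_≡_)
open import Relation.Nullary using (Dec)
open import Relation.Nullary.Decidable using (_×-dec_)

Σℤ : List ℤ → ℤ
Σℤ = foldr _+_ (+ 0)

Πℤ : List ℤ → ℤ
Πℤ = foldr _*_ (+ 1)

-- steps: H = (1,0), R = (2,1)
data Step : Set where
  H R : Step

allWords : ℕ → List (List Step)
allWords zero    = [] ∷ []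
allWords (suc l) = concatMap (λ w → (H ∷ w) ∷ (R ∷ w) ∷ []) (allWords l)

endpoint : ℕ → ℕ → List Step → ℕ × ℕ
endpoint x y []      = x , y
endpoint x y (H ∷ s) = endpoint (suc x) y s
endpoint x y (R ∷ s) = endpoint (suc (suc x)) (suc y) s

EndsAt : ℕ → ℤ → ℕ → List Step → Set
EndsAt r n k s = (+ proj₁ (endpoint r 0 s) ≡ n) × (proj₂ (endpoint r 0 s) ≡ k)

endsAt? : (r : ℕ) (n : ℤ) (k : ℕ) (s : List Step) → Dec (EndsAt r n k s)
endsAt? r n k s = (+ proj₁ (endpoint r 0 s) ℤ.≟ n) ×-dec (proj₂ (endpoint r 0 s) ℕ.≟ k)

paths : ℕ → ℤ → ℕ → List (List Step)
paths r n k with n - + r - + k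
... | + l      = filter (endsAt? r n k) (allWords l)
... | -[1+ _ ] = []

wordWeight : ℤ → ℕ → List Step → ℤ
wordWeight i y []      = + 1
wordWeight i y (H ∷ s) = (+ 2 * i + + 2 * (+ y + + 1)) * wordWeight i y s
wordWeight i y (R ∷ s) = ((+ y + i + + 1) * (+ y + i + + 2)) * wordWeight i (suc y) s

w : ℤ → ℕ → ℤ → ℕ → ℤ
w i r n k = Σℤ (map (wordWeight i 0) (paths r n k))

allVecs : (len b : ℕ) → List (Vec ℕ len)
allVecs zero    b = V.[] ∷ []
allVecs (suc l) b = concatMap (λ v → map (λ j → j V.∷ v) (upTo (suc b))) (allVecs l b)

tuplesWithSum : (len s : ℕ) → List (Vec ℕ len)
tuplesWithSum len s = filter (λ t → V.sum t ℕ.≟ s) (allVecs len s)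

risingProd : ℤ → ℕ → ℤ
risingProd i k = Πℤ (map (λ m → (+ m + i + + 1) * (+ m + i + + 2)) (upTo k))

tupleSum : ℤ → ℕ → ℕ → ℤ
tupleSum i k h =
  Σℤ (map (λ t → Πℤ (V.toList (tabulate {n = suc k} (λ m → (i + + toℕ m + + 1) ^ lookup t m))))
          (tuplesWithSum (suc k) h))

-- right-hand side 2^{n-r-2k} ∏ … ∑ …; when n-r-2k < 0 the sum over
-- tuples is empty, so the right-hand side is 0
rhs : ℤ → ℕ → ℤ → ℕ → ℤ
rhs i r n k with n - + r - + (2 ℕ.* k)
... | + h      = ((+ 2) ^ h) * risingProd i k * tupleSum i k h
... | -[1+ _ ] = + 0

-- Write c y = i + y + 1, so that a horizontal step at height y weighs 2 c y and a rise from
-- height y weighs c y c (y+1). Splitting off the first step, the weighted sum P l y j over the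
-- words of length l that start at height y and rise j times satisfies
--   P (l+1) y j = 2 c y P l y j + c y c (y+1) P l (y+1) (j-1).
-- With h = l - j, the candidate 2^h ∏_{m<j} c (y+m) c (y+m+1) · h_h (c y, …, c (y+j)), where h_h is
-- the complete homogeneous symmetric polynomial, obeys the same recursion because
--   h_d (x_0, …, x_j) = h_d (x_1, …, x_j) + x_0 h_{d-1} (x_0, …, x_j).
-- The sum over tuples in the statement is h_h (c 0, …, c k) written out, and both sides vanish
-- when a path would need more rises than steps.

module Submission where

open import Defs
open import Data.Nat using (ℕ)
open import Data.Integer using (ℤ)
open import Relation.Binary.PropositionalEquality using (_≡_)

open import Data.Bool using (true; false; if_then_else_)
open import Data.Fin using (toℕ)
open import Data.Integer using (+_; -[1+_]; _+_; _*_; _-_; _^_; sign)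
import Data.Integer.Properties as ℤP
open import Data.Integer.Tactic.RingSolver using (solve-∀)
open import Data.List using (List; []; _∷_; _++_; map; concatMap; filter; length; upTo; applyUpTo)
import Data.List.Properties as List
open import Data.List.Relation.Unary.All as All using (All; []; _∷_)
import Data.List.Relation.Unary.All.Properties as All
import Data.Nat as ℕ
import Data.Nat.Properties as ℕP
import Data.Nat.Tactic.RingSolver as ℕSolver
open import Data.Product using (_,_; proj₁; proj₂)
import Data.Sign as Sign
open import Data.Vec as Vec using (Vec; lookup; tabulate)
import Data.Vec.Properties as Vec
open import Function using (_∘_; _⇔_; mk⇔)
open import Level using (Level)
open import Relation.Binary.PropositionalEquality using (refl; sym; trans; cong; cong₂; module ≡-Reasoning)
open import Relation.Nullary using (does; yes; no)
open import Relation.Nullary.Decidable using (dec-true; dec-false; does-⇔)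
open import Relation.Unary using (Pred; Decidable)

open ≡-Reasoning

Σℤ-++ : ∀ xs ys → Σℤ (xs ++ ys) ≡ Σℤ xs + Σℤ ys
Σℤ-++ []       ys = sym (ℤP.+-identityˡ _)
Σℤ-++ (x ∷ xs) ys = trans (cong (_+_ x) (Σℤ-++ xs ys)) (sym (ℤP.+-assoc x _ _))

Σℤ-map-concatMap : ∀ {A B : Set} (f : B → ℤ) (g : A → List B) xs →
                   Σℤ (map f (concatMap g xs)) ≡ Σℤ (map (λ x → Σℤ (map f (g x))) xs)
Σℤ-map-concatMap f g []       = refl
Σℤ-map-concatMap f g (x ∷ xs) = begin
  Σℤ (map f (g x ++ concatMap g xs))               ≡⟨ cong Σℤ (List.map-++ f (g x) _) ⟩
  Σℤ (map f (g x) ++ map f (concatMap g xs))        ≡⟨ Σℤ-++ (map f (g x)) _ ⟩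
  Σℤ (map f (g x)) + Σℤ (map f (concatMap g xs))    ≡⟨ cong (_+_ (Σℤ (map f (g x)))) (Σℤ-map-concatMap f g xs) ⟩
  Σℤ (map f (g x)) + Σℤ (map (λ x → Σℤ (map f (g x))) xs) ∎

Σℤ-map-cong : ∀ {A : Set} {f g : A → ℤ} → (∀ x → f x ≡ g x) → ∀ xs → Σℤ (map f xs) ≡ Σℤ (map g xs)
Σℤ-map-cong f≗g xs = cong Σℤ (List.map-cong f≗g xs)

Σℤ-map-+ : ∀ {A : Set} (f g : A → ℤ) xs → Σℤ (map (λ x → f x + g x) xs) ≡ Σℤ (map f xs) + Σℤ (map g xs)
Σℤ-map-+ f g []       = refl
Σℤ-map-+ f g (x ∷ xs) = trans (cong (_+_ (f x + g x)) (Σℤ-map-+ f g xs)) (interchange (f x) (g x) _ _)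
  where
  interchange : ∀ a b c d → (a + b) + (c + d) ≡ (a + c) + (b + d)
  interchange = solve-∀

Σℤ-map-*ˡ : ∀ {A : Set} a (f : A → ℤ) xs → Σℤ (map (λ x → a * f x) xs) ≡ a * Σℤ (map f xs)
Σℤ-map-*ˡ a f []       = sym (ℤP.*-zeroʳ a)
Σℤ-map-*ˡ a f (x ∷ xs) = trans (cong (_+_ (a * f x)) (Σℤ-map-*ˡ a f xs)) (sym (ℤP.*-distribˡ-+ a (f x) _))

Σℤ-map-zero : ∀ {A : Set} (f : A → ℤ) → (∀ x → f x ≡ + 0) → ∀ xs → Σℤ (map f xs) ≡ + 0
Σℤ-map-zero f f≗0 []       = refl
Σℤ-map-zero f f≗0 (x ∷ xs) = cong₂ _+_ (f≗0 x) (Σℤ-map-zero f f≗0 xs)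

Σℤ-map-swap : ∀ {A B : Set} (F : A → B → ℤ) xs ys →
              Σℤ (map (λ x → Σℤ (map (F x) ys)) xs) ≡ Σℤ (map (λ y → Σℤ (map (λ x → F x y) xs)) ys)
Σℤ-map-swap F []       ys = sym (Σℤ-map-zero _ (λ _ → refl) ys)
Σℤ-map-swap F (x ∷ xs) ys = trans (cong (_+_ (Σℤ (map (F x) ys))) (Σℤ-map-swap F xs ys))
                                  (sym (Σℤ-map-+ (F x) _ ys))

Σℤ-map-filter : ∀ {A : Set} {ℓ : Level} {P : Pred A ℓ} (P? : Decidable P) (f : A → ℤ) xs →
                Σℤ (map f (filter P? xs)) ≡ Σℤ (map (λ x → if does (P? x) then f x else + 0) xs)
Σℤ-map-filter P? f []       = refl
Σℤ-map-filter P? f (x ∷ xs) with does (P? x)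
... | true  = cong (_+_ (f x)) (Σℤ-map-filter P? f xs)
... | false = trans (Σℤ-map-filter P? f xs) (sym (ℤP.+-identityˡ _))

*-if-zero : ∀ a b x → a * (if b then x else + 0) ≡ (if b then a * x else + 0)
*-if-zero a true  x = refl
*-if-zero a false x = ℤP.*-zeroʳ a

sumUpTo : (ℕ → ℤ) → ℕ → ℤ
sumUpTo F ℕ.zero    = + 0
sumUpTo F (ℕ.suc n) = F 0 + sumUpTo (F ∘ ℕ.suc) n

Σℤ-applyUpTo : ∀ F n → Σℤ (applyUpTo F n) ≡ sumUpTo F n
Σℤ-applyUpTo F ℕ.zero    = refl
Σℤ-applyUpTo F (ℕ.suc n) = cong (_+_ (F 0)) (Σℤ-applyUpTo (F ∘ ℕ.suc) n)

sumUpTo-cong : ∀ {F G} n → (∀ j → j ℕ.< n → F j ≡ G j) → sumUpTo F n ≡ sumUpTo G n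
sumUpTo-cong ℕ.zero    F≗G = refl
sumUpTo-cong (ℕ.suc n) F≗G =
  cong₂ _+_ (F≗G 0 ℕ.z<s) (sumUpTo-cong n (λ j j<n → F≗G (ℕ.suc j) (ℕ.s<s j<n)))

sumUpTo-*ˡ : ∀ a F n → sumUpTo (λ j → a * F j) n ≡ a * sumUpTo F n
sumUpTo-*ˡ a F ℕ.zero    = sym (ℤP.*-zeroʳ a)
sumUpTo-*ˡ a F (ℕ.suc n) = trans (cong (_+_ (a * F 0)) (sumUpTo-*ˡ a (F ∘ ℕ.suc) n))
                                  (sym (ℤP.*-distribˡ-+ a (F 0) _))

sumUpTo-zero : ∀ F → (∀ j → F j ≡ + 0) → ∀ n → sumUpTo F n ≡ + 0
sumUpTo-zero F F≗0 ℕ.zero    = refl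
sumUpTo-zero F F≗0 (ℕ.suc n) = cong₂ _+_ (F≗0 0) (sumUpTo-zero (F ∘ ℕ.suc) (F≗0 ∘ ℕ.suc) n)

sumUpTo-vanishing-tail : ∀ F n m → (∀ d → F (n ℕ.+ d) ≡ + 0) → sumUpTo F (n ℕ.+ m) ≡ sumUpTo F n
sumUpTo-vanishing-tail F ℕ.zero    m tail≗0 = sumUpTo-zero F tail≗0 m
sumUpTo-vanishing-tail F (ℕ.suc n) m tail≗0 = cong (_+_ (F 0)) (sumUpTo-vanishing-tail (F ∘ ℕ.suc) n m tail≗0)

sumUpTo-truncate : ∀ F {d b} → d ℕ.≤ b → (∀ {j} → d ℕ.< j → F j ≡ + 0) →
                   sumUpTo F (ℕ.suc b) ≡ sumUpTo F (ℕ.suc d)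
sumUpTo-truncate F {d} {b} d≤b F>d≡0 = begin
  sumUpTo F (ℕ.suc b)
    ≡⟨ cong (sumUpTo F ∘ ℕ.suc) (sym (ℕP.m+[n∸m]≡n d≤b)) ⟩
  sumUpTo F (ℕ.suc d ℕ.+ (b ℕ.∸ d))
    ≡⟨ sumUpTo-vanishing-tail F (ℕ.suc d) (b ℕ.∸ d) (λ e → F>d≡0 (ℕP.m≤m+n (ℕ.suc d) e)) ⟩
  sumUpTo F (ℕ.suc d) ∎

Σℤ-allVecs-suc : ∀ {l} (f : Vec ℕ (ℕ.suc l) → ℤ) b →
                 Σℤ (map f (allVecs (ℕ.suc l) b))
                 ≡ sumUpTo (λ j → Σℤ (map (λ v → f (j Vec.∷ v)) (allVecs l b))) (ℕ.suc b)
Σℤ-allVecs-suc {l} f b = begin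
  Σℤ (map f (allVecs (ℕ.suc l) b))
    ≡⟨ Σℤ-map-concatMap f (λ v → map (Vec._∷ v) (upTo (ℕ.suc b))) (allVecs l b) ⟩
  Σℤ (map (λ v → Σℤ (map f (map (Vec._∷ v) (upTo (ℕ.suc b))))) (allVecs l b))
    ≡⟨ Σℤ-map-cong (λ v → cong Σℤ (sym (List.map-∘ {g = f} {f = Vec._∷ v} (upTo (ℕ.suc b))))) (allVecs l b) ⟩
  Σℤ (map (λ v → Σℤ (map (λ j → f (j Vec.∷ v)) (upTo (ℕ.suc b)))) (allVecs l b))
    ≡⟨ Σℤ-map-swap (λ v j → f (j Vec.∷ v)) (allVecs l b) (upTo (ℕ.suc b)) ⟩
  Σℤ (map slice (upTo (ℕ.suc b)))
    ≡⟨ cong Σℤ (List.map-upTo slice (ℕ.suc b)) ⟩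
  Σℤ (applyUpTo slice (ℕ.suc b))
    ≡⟨ Σℤ-applyUpTo slice (ℕ.suc b) ⟩
  sumUpTo slice (ℕ.suc b) ∎
  where
  slice : ℕ → ℤ
  slice j = Σℤ (map (λ v → f (j Vec.∷ v)) (allVecs l b))

module CompleteHomogeneous (c : ℕ → ℤ) where

  -- completeSym l y d is the complete homogeneous symmetric polynomial of degree d
  -- in c y, …, c (y + l - 1), expanded along the exponent j of c y.
  completeSym : ℕ → ℕ → ℕ → ℤ
  completeSym ℕ.zero    y ℕ.zero    = + 1
  completeSym ℕ.zero    y (ℕ.suc d) = + 0
  completeSym (ℕ.suc l) y d         = sumUpTo (λ j → c y ^ j * completeSym l (ℕ.suc y) (d ℕ.∸ j)) (ℕ.suc d)

  completeSym-zero : ∀ l y → completeSym l y 0 ≡ + 1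
  completeSym-zero ℕ.zero    y = refl
  completeSym-zero (ℕ.suc l) y rewrite completeSym-zero l (ℕ.suc y) = refl

  completeSym-suc : ∀ l y d → completeSym (ℕ.suc l) y (ℕ.suc d)
                              ≡ completeSym l (ℕ.suc y) (ℕ.suc d) + c y * completeSym (ℕ.suc l) y d
  completeSym-suc l y d =
    cong₂ _+_ (ℤP.*-identityˡ (completeSym l (ℕ.suc y) (ℕ.suc d)))
              (trans (sumUpTo-cong {λ j → c y ^ ℕ.suc j * term j} (ℕ.suc d)
                                   (λ j _ → ℤP.*-assoc (c y) (c y ^ j) (term j)))
                     (sumUpTo-*ˡ (c y) (λ j → c y ^ j * term j) (ℕ.suc d)))
    where
    term : ℕ → ℤ
    term j = completeSym l (ℕ.suc y) (d ℕ.∸ j)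

  monomial : ∀ {l} → ℕ → Vec ℕ l → ℤ
  monomial y Vec.[]       = + 1
  monomial y (t Vec.∷ ts) = c y ^ t * monomial (ℕ.suc y) ts

  Πℤ-tabulate≡monomial : ∀ {l} y (t : Vec ℕ l) →
                         Πℤ (Vec.toList (tabulate (λ m → c (y ℕ.+ toℕ m) ^ lookup t m))) ≡ monomial y t
  Πℤ-tabulate≡monomial y Vec.[]       = refl
  Πℤ-tabulate≡monomial y (t Vec.∷ ts) =
    cong₂ _*_ (cong (λ z → c z ^ t) (ℕP.+-identityʳ y))
              (trans (cong (Πℤ ∘ Vec.toList)
                           (Vec.tabulate-cong (λ m → cong (λ z → c z ^ lookup ts m) (ℕP.+-suc y (toℕ m)))))
                     (Πℤ-tabulate≡monomial (ℕ.suc y) ts))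

  monomialOfDegree : ∀ {l} → ℕ → ℕ → Vec ℕ l → ℤ
  monomialOfDegree y d t = if does (Vec.sum t ℕ.≟ d) then monomial y t else + 0

  Σ-monomialOfDegree : ∀ l b y d → d ℕ.≤ b →
                       Σℤ (map (monomialOfDegree y d) (allVecs l b)) ≡ completeSym l y d
  Σ-monomialOfDegree ℕ.zero    b y ℕ.zero    _   = refl
  Σ-monomialOfDegree ℕ.zero    b y (ℕ.suc d) _   = refl
  Σ-monomialOfDegree (ℕ.suc l) b y d         d≤b = begin
    Σℤ (map (monomialOfDegree y d) (allVecs (ℕ.suc l) b))
      ≡⟨ Σℤ-allVecs-suc {l} (monomialOfDegree y d) b ⟩
    sumUpTo (λ j → Σℤ (map (λ v → monomialOfDegree y d (j Vec.∷ v)) (allVecs l b))) (ℕ.suc b)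
      ≡⟨ sumUpTo-cong (ℕ.suc b) (λ j _ → Σ-first-exponent j) ⟩
    sumUpTo term (ℕ.suc b)
      ≡⟨ sumUpTo-truncate term d≤b (λ d<j → term-> d<j) ⟩
    sumUpTo term (ℕ.suc d)
      ≡⟨ sumUpTo-cong {term} {summand} (ℕ.suc d) (λ j j<1+d → term-≤ (ℕP.<⇒≤pred j<1+d)) ⟩
    completeSym (ℕ.suc l) y d ∎
    where
    summand term : ℕ → ℤ
    summand j = c y ^ j * completeSym l (ℕ.suc y) (d ℕ.∸ j)
    term j = if does (j ℕ.≤? d) then summand j else + 0

    term-≤ : ∀ {j} → j ℕ.≤ d → term j ≡ summand j
    term-≤ {j} j≤d = cong (λ b → if b then summand j else + 0) (dec-true (j ℕ.≤? d) j≤d)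

    term-> : ∀ {j} → d ℕ.< j → term j ≡ + 0
    term-> {j} d<j = cong (λ b → if b then summand j else + 0) (dec-false (j ℕ.≤? d) (ℕP.<⇒≱ d<j))

    Σ-first-exponent : ∀ j → Σℤ (map (λ v → monomialOfDegree y d (j Vec.∷ v)) (allVecs l b)) ≡ term j
    Σ-first-exponent j with j ℕ.≤? d
    ... | yes j≤d = begin
      Σℤ (map (λ v → monomialOfDegree y d (j Vec.∷ v)) (allVecs l b))
        ≡⟨ Σℤ-map-cong (λ v → trans (cong (λ b → if b then c y ^ j * monomial (ℕ.suc y) v else + 0)
                                          (shift-degree v))
                                    (sym (*-if-zero (c y ^ j) _ _)))
                       (allVecs l b) ⟩
      Σℤ (map (λ v → c y ^ j * monomialOfDegree (ℕ.suc y) (d ℕ.∸ j) v) (allVecs l b))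
        ≡⟨ Σℤ-map-*ˡ (c y ^ j) _ (allVecs l b) ⟩
      c y ^ j * Σℤ (map (monomialOfDegree (ℕ.suc y) (d ℕ.∸ j)) (allVecs l b))
        ≡⟨ cong (c y ^ j *_) (Σ-monomialOfDegree l b (ℕ.suc y) (d ℕ.∸ j) (ℕP.≤-trans (ℕP.m∸n≤m d j) d≤b)) ⟩
      summand j
        ≡⟨ sym (term-≤ j≤d) ⟩
      term j ∎
      where
      shift-degree : ∀ v → does (j ℕ.+ Vec.sum v ℕ.≟ d) ≡ does (Vec.sum v ℕ.≟ d ℕ.∸ j)
      shift-degree v = does-⇔ (mk⇔ (λ e → trans (sym (ℕP.m+n∸m≡n j (Vec.sum v))) (cong (ℕ._∸ j) e))
                                   (λ e → trans (cong (j ℕ.+_) e) (ℕP.m+[n∸m]≡n j≤d)))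
                                   (j ℕ.+ Vec.sum v ℕ.≟ d) (Vec.sum v ℕ.≟ d ℕ.∸ j)
    ... | no j≰d =
      trans (Σℤ-map-zero (λ v → monomialOfDegree y d (j Vec.∷ v)) too-large (allVecs l b))
            (sym (term-> (ℕP.≰⇒> j≰d)))
      where
      too-large : ∀ v → monomialOfDegree y d (j Vec.∷ v) ≡ + 0
      too-large v = cong (λ b → if b then c y ^ j * monomial (ℕ.suc y) v else + 0)
                         (dec-false (j ℕ.+ Vec.sum v ℕ.≟ d)
                                    (λ e → j≰d (ℕP.≤-trans (ℕP.m≤m+n j _) (ℕP.≤-reflexive e))))

module WeightedPaths (c : ℕ → ℤ) where

  open CompleteHomogeneous c

  -- pathSum l y j sums, over the words of length l with exactly j rises started at
  -- height y, the products of the step weights 2 c y (horizontal) and c y c (y+1) (rise).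
  pathSum : ℕ → ℕ → ℕ → ℤ
  pathSum ℕ.zero    y ℕ.zero    = + 1
  pathSum ℕ.zero    y (ℕ.suc j) = + 0
  pathSum (ℕ.suc l) y ℕ.zero    = + 2 * c y * pathSum l y 0
  pathSum (ℕ.suc l) y (ℕ.suc j) = + 2 * c y * pathSum l y (ℕ.suc j) + c y * c (ℕ.suc y) * pathSum l (ℕ.suc y) j

  riseProd : ℕ → ℕ → ℤ
  riseProd y ℕ.zero    = + 1
  riseProd y (ℕ.suc j) = c y * c (ℕ.suc y) * riseProd (ℕ.suc y) j

  pathSum-short : ∀ {l j} y → l ℕ.< j → pathSum l y j ≡ + 0
  pathSum-short {ℕ.zero}  {ℕ.suc j} y l<j = refl
  pathSum-short {ℕ.suc l} {ℕ.suc j} y (ℕ.s<s l<j)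
    rewrite pathSum-short y (ℕP.m<n⇒m<1+n l<j) | pathSum-short (ℕ.suc y) l<j
          | ℤP.*-zeroʳ (+ 2 * c y) | ℤP.*-zeroʳ (c y * c (ℕ.suc y)) = refl

  pathSum-all-rises : ∀ j y → pathSum j y j ≡ riseProd y j
  pathSum-all-rises ℕ.zero    y = refl
  pathSum-all-rises (ℕ.suc j) y
    rewrite pathSum-short {j} y (ℕP.n<1+n j) | pathSum-all-rises j (ℕ.suc y)
          | ℤP.*-zeroʳ (+ 2 * c y) = ℤP.+-identityˡ _

  pathSum-closedForm : ∀ h j y → pathSum (h ℕ.+ j) y j ≡ (+ 2) ^ h * riseProd y j * completeSym (ℕ.suc j) y h
  pathSum-closedForm ℕ.zero j y = begin
    pathSum j y j                               ≡⟨ pathSum-all-rises j y ⟩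
    riseProd y j                                ≡⟨ unit-factors (riseProd y j) ⟩
    + 1 * riseProd y j * + 1                    ≡⟨ cong (+ 1 * riseProd y j *_) (sym (completeSym-zero (ℕ.suc j) y)) ⟩
    + 1 * riseProd y j * completeSym (ℕ.suc j) y 0 ∎
    where
    unit-factors : ∀ x → x ≡ + 1 * x * + 1
    unit-factors = solve-∀
  pathSum-closedForm (ℕ.suc h) ℕ.zero y = begin
    + 2 * c y * pathSum (h ℕ.+ 0) y 0
      ≡⟨ cong (+ 2 * c y *_) (pathSum-closedForm h 0 y) ⟩
    + 2 * c y * ((+ 2) ^ h * + 1 * completeSym 1 y h)
      ≡⟨ regroup (c y) ((+ 2) ^ h) (completeSym 1 y h) ⟩
    + 2 * (+ 2) ^ h * + 1 * (+ 0 + c y * completeSym 1 y h)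
      ≡⟨ cong (+ 2 * (+ 2) ^ h * + 1 *_) (sym (completeSym-suc 0 y h)) ⟩
    + 2 * (+ 2) ^ h * + 1 * completeSym 1 y (ℕ.suc h) ∎
    where
    regroup : ∀ a p x → + 2 * a * (p * + 1 * x) ≡ + 2 * p * + 1 * (+ 0 + a * x)
    regroup = solve-∀
  pathSum-closedForm (ℕ.suc h) (ℕ.suc j) y = begin
    + 2 * c y * pathSum (h ℕ.+ ℕ.suc j) y (ℕ.suc j) + c y * c (ℕ.suc y) * pathSum (h ℕ.+ ℕ.suc j) (ℕ.suc y) j
      ≡⟨ cong₂ (λ u v → + 2 * c y * u + c y * c (ℕ.suc y) * v)
               (pathSum-closedForm h (ℕ.suc j) y)
               (trans (cong (λ l → pathSum l (ℕ.suc y) j) (ℕP.+-suc h j)) (pathSum-closedForm (ℕ.suc h) j (ℕ.suc y))) ⟩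
    + 2 * c y * ((+ 2) ^ h * riseProd y (ℕ.suc j) * completeSym (ℕ.suc (ℕ.suc j)) y h)
      + c y * c (ℕ.suc y) * ((+ 2) ^ ℕ.suc h * riseProd (ℕ.suc y) j * completeSym (ℕ.suc j) (ℕ.suc y) (ℕ.suc h))
      ≡⟨ regroup (c y) (c (ℕ.suc y)) ((+ 2) ^ h) (riseProd (ℕ.suc y) j) _ _ ⟩
    (+ 2) ^ ℕ.suc h * riseProd y (ℕ.suc j)
      * (completeSym (ℕ.suc j) (ℕ.suc y) (ℕ.suc h) + c y * completeSym (ℕ.suc (ℕ.suc j)) y h)
      ≡⟨ cong ((+ 2) ^ ℕ.suc h * riseProd y (ℕ.suc j) *_) (sym (completeSym-suc (ℕ.suc j) y h)) ⟩
    (+ 2) ^ ℕ.suc h * riseProd y (ℕ.suc j) * completeSym (ℕ.suc (ℕ.suc j)) y (ℕ.suc h) ∎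
    where
    regroup : ∀ a a′ p r x x′ → + 2 * a * (p * (a * a′ * r) * x) + a * a′ * (+ 2 * p * r * x′)
                               ≡ + 2 * p * (a * a′ * r) * (x′ + a * x)
    regroup = solve-∀

  Πℤ-applyUpTo≡riseProd : ∀ (f : ℕ → ℤ) y j → (∀ m → f m ≡ c (y ℕ.+ m) * c (ℕ.suc (y ℕ.+ m))) →
                          Πℤ (applyUpTo f j) ≡ riseProd y j
  Πℤ-applyUpTo≡riseProd f y ℕ.zero    f≗ = refl
  Πℤ-applyUpTo≡riseProd f y (ℕ.suc j) f≗ =
    cong₂ _*_ (trans (f≗ 0) (cong (λ z → c z * c (ℕ.suc z)) (ℕP.+-identityʳ y)))
              (Πℤ-applyUpTo≡riseProd (f ∘ ℕ.suc) (ℕ.suc y) j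
                 (λ m → trans (f≗ (ℕ.suc m)) (cong (λ z → c z * c (ℕ.suc z)) (ℕP.+-suc y m))))

rises : List Step → ℕ
rises []      = 0
rises (H ∷ s) = rises s
rises (R ∷ s) = ℕ.suc (rises s)

endpoint-x : ∀ x y s → proj₁ (endpoint x y s) ≡ x ℕ.+ (length s ℕ.+ rises s)
endpoint-x x y []      = sym (ℕP.+-identityʳ x)
endpoint-x x y (H ∷ s) = trans (endpoint-x (ℕ.suc x) y s) (sym (ℕP.+-suc x _))
endpoint-x x y (R ∷ s) = trans (endpoint-x (ℕ.suc (ℕ.suc x)) (ℕ.suc y) s) (two-more x (length s) (rises s))
  where
  two-more : ∀ x l r → ℕ.suc (ℕ.suc x) ℕ.+ (l ℕ.+ r) ≡ x ℕ.+ (ℕ.suc l ℕ.+ ℕ.suc r)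
  two-more = ℕSolver.solve-∀

endpoint-height : ∀ x y s → proj₂ (endpoint x y s) ≡ y ℕ.+ rises s
endpoint-height x y []      = sym (ℕP.+-identityʳ y)
endpoint-height x y (H ∷ s) = endpoint-height (ℕ.suc x) y s
endpoint-height x y (R ∷ s) = trans (endpoint-height (ℕ.suc (ℕ.suc x)) (ℕ.suc y) s) (sym (ℕP.+-suc y (rises s)))

endsAt⇔rises : ∀ {r n k l s} → n ≡ + (r ℕ.+ (l ℕ.+ k)) → length s ≡ l → EndsAt r n k s ⇔ (rises s ≡ k)
endsAt⇔rises {r} {n} {k} {l} {s} n≡r+l+k |s|≡l = mk⇔
  (λ (_ , height≡k) → trans (sym (endpoint-height r 0 s)) height≡k)
  (λ rises≡k → trans (cong +_ (trans (endpoint-x r 0 s) (cong₂ (λ a b → r ℕ.+ (a ℕ.+ b)) |s|≡l rises≡k)))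
                     (sym n≡r+l+k)
             , trans (endpoint-height r 0 s) rises≡k)

allWords-length : ∀ l → All (λ s → length s ≡ l) (allWords l)
allWords-length ℕ.zero    = refl ∷ []
allWords-length (ℕ.suc l) =
  All.concat⁺ (All.map⁺ (All.map (λ e → cong ℕ.suc e ∷ cong ℕ.suc e ∷ []) (allWords-length l)))

Σℤ-allWords-suc : ∀ (f : List Step → ℤ) l →
                  Σℤ (map f (allWords (ℕ.suc l))) ≡ Σℤ (map (λ s → f (H ∷ s) + f (R ∷ s)) (allWords l))
Σℤ-allWords-suc f l =
  trans (Σℤ-map-concatMap f (λ s → (H ∷ s) ∷ (R ∷ s) ∷ []) (allWords l))
        (Σℤ-map-cong (λ s → cong (_+_ (f (H ∷ s))) (ℤP.+-identityʳ (f (R ∷ s)))) (allWords l))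

n≡r+l+k : ∀ {r n k l} → n - + r - + k ≡ + l → n ≡ + (r ℕ.+ (l ℕ.+ k))
n≡r+l+k {r} {n} {k} {l} eq = begin
  n                                ≡⟨ regroup n (+ r) (+ k) ⟩
  + r + ((n - + r - + k) + + k)    ≡⟨ cong (λ d → + r + (d + + k)) eq ⟩
  + r + (+ l + + k)                ≡⟨ sym (trans (ℤP.pos-+ r (l ℕ.+ k)) (cong (_+_ (+ r)) (ℤP.pos-+ l k))) ⟩
  + (r ℕ.+ (l ℕ.+ k))              ∎
  where
  regroup : ∀ n r k → n ≡ r + ((n - r - k) + k)
  regroup = solve-∀

n-r-2k≡n-r-k-k : ∀ n r k → n - + r - + (2 ℕ.* k) ≡ (n - + r - + k) - + k
n-r-2k≡n-r-k-k n r k = trans (cong (λ z → n - + r - z) (ℤP.pos-* 2 k)) (regroup n (+ r) (+ k))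
  where
  regroup : ∀ n r k → n - r - + 2 * k ≡ (n - r - k) - k
  regroup = solve-∀

module _ (i : ℤ) where

  private
    c : ℕ → ℤ
    c y = i + + y + + 1

  open CompleteHomogeneous c
  open WeightedPaths c

  horizontal-weight : ∀ y → + 2 * i + + 2 * (+ y + + 1) ≡ + 2 * c y
  horizontal-weight y = regroup i (+ y)
    where
    regroup : ∀ i y → + 2 * i + + 2 * (y + + 1) ≡ + 2 * (i + y + + 1)
    regroup = solve-∀

  rise-weight : ∀ y → (+ y + i + + 1) * (+ y + i + + 2) ≡ c y * c (ℕ.suc y)
  rise-weight y = trans (regroup i (+ y)) (cong (λ z → c y * (i + z + + 1)) (sym (ℤP.pos-+ 1 y)))
    where
    regroup : ∀ i y → (y + i + + 1) * (y + i + + 2) ≡ (i + y + + 1) * (i + (+ 1 + y) + + 1)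
    regroup = solve-∀

  weightWithRises : ℕ → ℕ → List Step → ℤ
  weightWithRises y j s = if does (rises s ℕ.≟ j) then wordWeight i y s else + 0

  weightWithRises-H : ∀ y j s → weightWithRises y j (H ∷ s) ≡ + 2 * c y * weightWithRises y j s
  weightWithRises-H y j s =
    trans (cong (λ a → if does (rises s ℕ.≟ j) then a * wordWeight i y s else + 0) (horizontal-weight y))
          (sym (*-if-zero (+ 2 * c y) _ _))

  weightWithRises-R : ∀ y j s → weightWithRises y (ℕ.suc j) (R ∷ s) ≡ c y * c (ℕ.suc y) * weightWithRises (ℕ.suc y) j s
  weightWithRises-R y j s =
    trans (cong (λ a → if does (rises s ℕ.≟ j) then a * wordWeight i (ℕ.suc y) s else + 0) (rise-weight y))
          (sym (*-if-zero (c y * c (ℕ.suc y)) _ _))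

  Σ-weightWithRises : ∀ l y j → Σℤ (map (weightWithRises y j) (allWords l)) ≡ pathSum l y j
  Σ-weightWithRises ℕ.zero    y ℕ.zero    = refl
  Σ-weightWithRises ℕ.zero    y (ℕ.suc j) = refl
  Σ-weightWithRises (ℕ.suc l) y ℕ.zero    = begin
    Σℤ (map (weightWithRises y 0) (allWords (ℕ.suc l)))
      ≡⟨ Σℤ-allWords-suc (weightWithRises y 0) l ⟩
    Σℤ (map (λ s → weightWithRises y 0 (H ∷ s) + + 0) (allWords l))
      ≡⟨ Σℤ-map-cong (λ s → trans (ℤP.+-identityʳ _) (weightWithRises-H y 0 s)) (allWords l) ⟩
    Σℤ (map (λ s → + 2 * c y * weightWithRises y 0 s) (allWords l))
      ≡⟨ Σℤ-map-*ˡ (+ 2 * c y) (weightWithRises y 0) (allWords l) ⟩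
    + 2 * c y * Σℤ (map (weightWithRises y 0) (allWords l))
      ≡⟨ cong (+ 2 * c y *_) (Σ-weightWithRises l y 0) ⟩
    + 2 * c y * pathSum l y 0 ∎
  Σ-weightWithRises (ℕ.suc l) y (ℕ.suc j) = begin
    Σℤ (map (weightWithRises y (ℕ.suc j)) (allWords (ℕ.suc l)))
      ≡⟨ Σℤ-allWords-suc (weightWithRises y (ℕ.suc j)) l ⟩
    Σℤ (map (λ s → weightWithRises y (ℕ.suc j) (H ∷ s) + weightWithRises y (ℕ.suc j) (R ∷ s)) (allWords l))
      ≡⟨ Σℤ-map-cong (λ s → cong₂ _+_ (weightWithRises-H y (ℕ.suc j) s) (weightWithRises-R y j s)) (allWords l) ⟩
    Σℤ (map (λ s → + 2 * c y * weightWithRises y (ℕ.suc j) s + c y * c (ℕ.suc y) * weightWithRises (ℕ.suc y) j s)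
            (allWords l))
      ≡⟨ Σℤ-map-+ _ _ (allWords l) ⟩
    Σℤ (map (λ s → + 2 * c y * weightWithRises y (ℕ.suc j) s) (allWords l))
      + Σℤ (map (λ s → c y * c (ℕ.suc y) * weightWithRises (ℕ.suc y) j s) (allWords l))
      ≡⟨ cong₂ _+_ (trans (Σℤ-map-*ˡ (+ 2 * c y) (weightWithRises y (ℕ.suc j)) (allWords l))
                          (cong (+ 2 * c y *_) (Σ-weightWithRises l y (ℕ.suc j))))
                   (trans (Σℤ-map-*ˡ (c y * c (ℕ.suc y)) (weightWithRises (ℕ.suc y) j) (allWords l))
                          (cong (c y * c (ℕ.suc y) *_) (Σ-weightWithRises l (ℕ.suc y) j))) ⟩
    + 2 * c y * pathSum l y (ℕ.suc j) + c y * c (ℕ.suc y) * pathSum l (ℕ.suc y) j ∎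

  pathSumℤ : ℕ → ℤ → ℤ
  pathSumℤ k (+ l)     = pathSum l 0 k
  pathSumℤ k -[1+ _ ]  = + 0

  w≡pathSumℤ : ∀ r n k → w i r n k ≡ pathSumℤ k (n - + r - + k)
  -- The with-abstraction also reduces paths r n k, which splits on the same integer.
  w≡pathSumℤ r n k with n - + r - + k in eq
  ... | -[1+ _ ] = refl
  ... | + l = begin
    Σℤ (map (wordWeight i 0) (filter (endsAt? r n k) (allWords l)))
      ≡⟨ Σℤ-map-filter (endsAt? r n k) (wordWeight i 0) (allWords l) ⟩
    Σℤ (map (λ s → if does (endsAt? r n k s) then wordWeight i 0 s else + 0) (allWords l))
      ≡⟨ cong Σℤ (List.map-cong-local (All.map (λ {s} → ends-by-rises s) (allWords-length l))) ⟩
    Σℤ (map (weightWithRises 0 k) (allWords l))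
      ≡⟨ Σ-weightWithRises l 0 k ⟩
    pathSum l 0 k ∎
    where
    ends-by-rises : ∀ s → length s ≡ l → (if does (endsAt? r n k s) then wordWeight i 0 s else + 0)
                                           ≡ weightWithRises 0 k s
    ends-by-rises s |s|≡l = cong (λ b → if b then wordWeight i 0 s else + 0)
      (does-⇔ (endsAt⇔rises {r} {n} {k} {l} {s} (n≡r+l+k eq) |s|≡l) (endsAt? r n k s) (rises s ℕ.≟ k))

  closedForm : ℕ → ℤ → ℤ
  closedForm k (+ h)     = (+ 2) ^ h * risingProd i k * tupleSum i k h
  closedForm k -[1+ _ ]  = + 0

  rhs≡closedForm : ∀ r n k → rhs i r n k ≡ closedForm k (n - + r - + (2 ℕ.* k))
  rhs≡closedForm r n k with n - + r - + (2 ℕ.* k)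
  ... | + _      = refl
  ... | -[1+ _ ] = refl

  closedForm-negative : ∀ {k x} → sign x ≡ Sign.- → closedForm k x ≡ + 0
  closedForm-negative {x = -[1+ _ ]} _ = refl

  risingProd≡riseProd : ∀ k → risingProd i k ≡ riseProd 0 k
  risingProd≡riseProd k = trans (cong Πℤ (List.map-upTo _ k)) (Πℤ-applyUpTo≡riseProd _ 0 k rise-weight)

  tupleSum≡completeSym : ∀ k h → tupleSum i k h ≡ completeSym (ℕ.suc k) 0 h
  tupleSum≡completeSym k h = begin
    tupleSum i k h
      ≡⟨ Σℤ-map-filter (λ t → Vec.sum t ℕ.≟ h) _ (allVecs (ℕ.suc k) h) ⟩
    Σℤ (map (λ t → if does (Vec.sum t ℕ.≟ h)
                     then Πℤ (Vec.toList (tabulate (λ m → c (toℕ m) ^ lookup t m))) else + 0)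
            (allVecs (ℕ.suc k) h))
      ≡⟨ Σℤ-map-cong (λ t → cong (λ z → if does (Vec.sum t ℕ.≟ h) then z else + 0) (Πℤ-tabulate≡monomial 0 t))
                     (allVecs (ℕ.suc k) h) ⟩
    Σℤ (map (monomialOfDegree 0 h) (allVecs (ℕ.suc k) h))
      ≡⟨ Σ-monomialOfDegree (ℕ.suc k) h 0 h ℕP.≤-refl ⟩
    completeSym (ℕ.suc k) 0 h ∎

  pathSumℤ≡closedForm : ∀ k d → pathSumℤ k d ≡ closedForm k (d - + k)
  pathSumℤ≡closedForm ℕ.zero    -[1+ _ ] = refl
  pathSumℤ≡closedForm (ℕ.suc k) -[1+ _ ] = refl
  pathSumℤ≡closedForm k (+ l) with k ℕ.≤? l
  ... | yes k≤l = begin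
    pathSum l 0 k
      ≡⟨ cong (λ l → pathSum l 0 k) (sym (ℕP.m∸n+n≡m k≤l)) ⟩
    pathSum (l ℕ.∸ k ℕ.+ k) 0 k
      ≡⟨ pathSum-closedForm (l ℕ.∸ k) k 0 ⟩
    (+ 2) ^ (l ℕ.∸ k) * riseProd 0 k * completeSym (ℕ.suc k) 0 (l ℕ.∸ k)
      ≡⟨ cong₂ (λ a b → (+ 2) ^ (l ℕ.∸ k) * a * b)
               (sym (risingProd≡riseProd k)) (sym (tupleSum≡completeSym k (l ℕ.∸ k))) ⟩
    closedForm k (+ (l ℕ.∸ k))
      ≡⟨ cong (closedForm k) (sym (trans (ℤP.m-n≡m⊖n l k) (ℤP.⊖-≥ k≤l))) ⟩
    closedForm k (+ l - + k) ∎
  ... | no k≰l = trans (pathSum-short 0 l<k)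
                       (sym (closedForm-negative (trans (cong sign (ℤP.m-n≡m⊖n l k)) (ℤP.sign-⊖-< l<k))))
    where
    l<k : l ℕ.< k
    l<k = ℕP.≰⇒> k≰l

lemma3p3 : (i : ℤ) (r : ℕ) (n : ℤ) (k : ℕ) → w i r n k ≡ rhs i r n k
lemma3p3 i r n k = begin
  w i r n k                                   ≡⟨ w≡pathSumℤ i r n k ⟩
  pathSumℤ i k (n - + r - + k)                ≡⟨ pathSumℤ≡closedForm i k (n - + r - + k) ⟩
  closedForm i k (n - + r - + k - + k)        ≡⟨ cong (closedForm i k) (sym (n-r-2k≡n-r-k-k n r k)) ⟩
  closedForm i k (n - + r - + (2 ℕ.* k))      ≡⟨ sym (rhs≡closedForm i r n k) ⟩
  rhs i r n k                                 ∎
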